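{- Let $n\ge 4$ and write $n=2k+3+s$ with $k$ a nonnegative integer and $s\in\{0,1\}$. The Alternate Lucas cube $\mathcal{L}_n$ has exactly $4$ (unordered) pairs of vertices at distance equal to its diameter, namely (i) $0^s(10)^k001$ and $1^s(01)^k010$; (ii) $0^s(10)^k010$ and $1^s(01)^k001$; (iii) $0^s(10)^k100$ and $1^s(01)^k001$; (iv) $0^s(10)^k100$ and $1^s(01)^k010$.
   Context: For $n\ge1$, the hypercube $Q_n$ has vertex set $B_n=\{b_1\cdots b_n: b_i\in\{0,1\}\}$, two strings adjacent iff they differ in exactly one coordinate. For $n\ge3$, the Alternate Lucas cube $\mathcal{L}_n$ is the subgraph of $Q_n$ induced by the binary strings $b_1\cdots b_n$ with $b_ib_{i+1}=0$ for all $i\in\{1,\dots,n-1\}$ and additionally $b_{n-2}b_n=0$. Distances are graph distances in $\mathcal{L}_n$; its diameter is $n-1$. $0^s$, $1^s$ denote $s$ repeated symbols and $(10)^k$ the string $10$ repeated $k$ times. -}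

module Defs where

open import Data.Bool using (Bool; true; false; _∧_)
open import Data.Nat using (ℕ; zero; suc; _+_; _≤_)
open import Data.List using (List; []; _∷_; _++_; length; replicate; concat; reverse)
open import Data.Product using (_×_; Σ)
open import Data.Sum using (_⊎_)
open import Data.Unit using (⊤)
open import Relation.Binary.PropositionalEquality using (_≡_)

-- Binary strings b₁⋯bₙ are lists of booleans; 0 = false, 1 = true.
BStr : Set
BStr = List Bool

NoConsec : BStr → Set
NoConsec [] = ⊤
NoConsec (_ ∷ []) = ⊤
NoConsec (a ∷ b ∷ r) = (a ∧ b ≡ false) × NoConsec (b ∷ r)

-- b_{n-2} b_n = 0 (read off the last three letters; vacuous if length < 3)
LastCond′ : BStr → Set
LastCond′ (c ∷ _ ∷ a ∷ _) = a ∧ c ≡ false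
LastCond′ _ = ⊤

LastCond : BStr → Set
LastCond x = LastCond′ (reverse x)

IsVertex : ℕ → BStr → Set
IsVertex n x = (length x ≡ n) × NoConsec x × LastCond x

hamming : BStr → BStr → ℕ
hamming [] [] = 0
hamming [] (_ ∷ ys) = suc (hamming [] ys)
hamming (_ ∷ xs) [] = suc (hamming xs [])
hamming (true ∷ xs) (true ∷ ys) = hamming xs ys
hamming (false ∷ xs) (false ∷ ys) = hamming xs ys
hamming (true ∷ xs) (false ∷ ys) = suc (hamming xs ys)
hamming (false ∷ xs) (true ∷ ys) = suc (hamming xs ys)

Adj : ℕ → BStr → BStr → Set
Adj n x y = IsVertex n x × IsVertex n y × (hamming x y ≡ 1)

data Walk (n : ℕ) : BStr → BStr → ℕ → Set where
  here : ∀ {x} → IsVertex n x → Walk n x x 0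
  step : ∀ {x y z m} → Adj n x y → Walk n y z m → Walk n x z (suc m)

Dist : ℕ → BStr → BStr → ℕ → Set
Dist n x y d = Walk n x y d × (∀ m → Walk n x y m → d ≤ m)

zeros ones : ℕ → BStr
zeros s = replicate s false
ones s = replicate s true

p10 p01 : ℕ → BStr
p10 k = concat (replicate k (true ∷ false ∷ []))
p01 k = concat (replicate k (false ∷ true ∷ []))

b001 b010 b100 : BStr
b001 = false ∷ false ∷ true ∷ []
b010 = false ∷ true ∷ false ∷ []
b100 = true ∷ false ∷ false ∷ []

A B : ℕ → ℕ → BStr → BStr
A s k w = zeros s ++ p10 k ++ w
B s k w = ones s ++ p01 k ++ w

UPair : Set
UPair = BStr × BStr

SameUPair : UPair → UPair → Set
SameUPair (a Data.Product., b) (c Data.Product., d) = ((a ≡ c) × (b ≡ d)) ⊎ ((a ≡ d) × (b ≡ c))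

pairI pairII pairIII pairIV : ℕ → ℕ → UPair
pairI s k = A s k b001 Data.Product., B s k b010
pairII s k = A s k b010 Data.Product., B s k b001
pairIII s k = A s k b100 Data.Product., B s k b001
pairIV s k = A s k b100 Data.Product., B s k b010

Listed : ℕ → ℕ → BStr → BStr → Set
Listed s k x y =
  SameUPair (x Data.Product., y) (pairI s k) ⊎ SameUPair (x Data.Product., y) (pairII s k)
  ⊎ SameUPair (x Data.Product., y) (pairIII s k) ⊎ SameUPair (x Data.Product., y) (pairIV s k)

{-# OPTIONS --safe #-}
-- In 𝓛ₙ every vertex stays a vertex when 1s are turned into 0s, so a shortest path can
-- first clear the 1s of x missing in y and then set those of y: distances are Hamming
-- distances. A pair at distance n − 1 agrees in exactly one position. Two vertices of
-- length ≥ 3 cannot be complementary (the complement of a string without two consecutive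
-- 1s has no two consecutive 0s, so both alternate, and then b_{n-2} = b_n = 1 in one of
-- them), hence a diametral pair differs in its first letter, its tails form a diametral
-- pair of 𝓛ₙ₋₁, and the condition b₁b₂ = 0 on both strings forces the first letters.
-- Induction on n then reduces everything to the pairs of 𝓛₄, which are checked exhaustively.
module Submission where

open import Defs
open import Data.Nat using (ℕ; _+_; _*_; _∸_; _≤_)
open import Data.Product using (_×_)
open import Relation.Nullary using (¬_)
open import Relation.Binary.PropositionalEquality using (_≡_)
open import Function.Bundles using (_⇔_)

open import Data.Bool as Bool using (true; false; not; _∧_; f≤t; b≤b)
open import Data.Empty using (⊥-elim)
open import Data.List using (List; []; _∷_; _++_; _∷ʳ_; length; map; reverse)
open import Data.List.Membership.Propositional using (_∈_)
open import Data.List.Membership.Propositional.Properties using (∈-map⁺; ∈-++⁺ˡ; ∈-++⁺ʳ)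
open import Data.List.Properties using (≡-dec; ++-cancelˡ; unfold-reverse; length-reverse)
open import Data.List.Relation.Binary.Pointwise using (Pointwise; []; _∷_; Pointwise-length; reverse⁺)
open import Data.List.Relation.Unary.All as All using (all?)
open import Data.List.Relation.Unary.Any using (here)
open import Data.Nat using (zero; suc; z≤n; s≤s; _≟_)
open import Data.Nat.Properties using (≤-trans; ≤-antisym; n≤1+n; +-suc; +-assoc; +-comm; *-suc; suc-injective; 1+n≰n; m≤m+n)
open import Data.Product using (∃-syntax; _,_; proj₁; proj₂)
open import Data.Sum as Sum using (_⊎_; inj₁; inj₂; [_,_]′)
open import Data.Unit using (tt)
open import Function.Bundles using (mk⇔; Equivalence)
open import Function.Properties.Equivalence using () renaming (trans to ⇔-trans)
open import Relation.Binary.PropositionalEquality using (_≢_; refl; sym; trans; cong; cong₂; subst; module ≡-Reasoning)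
open import Relation.Nullary using (Dec; yes)
open import Relation.Nullary.Decidable using (True; toWitness; from-yes; _×-dec_; _⊎-dec_; _→-dec_; ¬?)

Diametral : ℕ → BStr → BStr → Set
Diametral n x y = IsVertex n x × IsVertex n y × hamming x y ≡ n ∸ 1

noConsec? : ∀ x → Dec (NoConsec x)
noConsec? [] = yes tt
noConsec? (_ ∷ []) = yes tt
noConsec? (a ∷ b ∷ r) = (a ∧ b Bool.≟ false) ×-dec noConsec? (b ∷ r)

lastCond? : ∀ x → Dec (LastCond x)
lastCond? x = lastCond′? (reverse x)
  where
  lastCond′? : ∀ r → Dec (LastCond′ r)
  lastCond′? (c ∷ _ ∷ a ∷ _) = a ∧ c Bool.≟ false
  lastCond′? [] = yes tt
  lastCond′? (_ ∷ []) = yes tt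
  lastCond′? (_ ∷ _ ∷ []) = yes tt

isVertex? : ∀ n x → Dec (IsVertex n x)
isVertex? n x = (length x ≟ n) ×-dec noConsec? x ×-dec lastCond? x

diametral? : ∀ n x y → Dec (Diametral n x y)
diametral? n x y = isVertex? n x ×-dec isVertex? n y ×-dec (hamming x y ≟ n ∸ 1)

listed? : ∀ s k x y → Dec (Listed s k x y)
listed? s k x y = same? (pairI s k) ⊎-dec same? (pairII s k) ⊎-dec same? (pairIII s k) ⊎-dec same? (pairIV s k)
  where
  _≟ₛ_ = ≡-dec Bool._≟_
  same? : ∀ p → Dec (SameUPair (x , y) p)
  same? (a , b) = ((x ≟ₛ a) ×-dec (y ≟ₛ b)) ⊎-dec ((x ≟ₛ b) ×-dec (y ≟ₛ a))

bitStrings : ℕ → List BStr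
bitStrings zero = [] ∷ []
bitStrings (suc n) = map (false ∷_) (bitStrings n) ++ map (true ∷_) (bitStrings n)

∈-bitStrings : ∀ x → x ∈ bitStrings (length x)
∈-bitStrings [] = here refl
∈-bitStrings (false ∷ x) = ∈-++⁺ˡ (∈-map⁺ (false ∷_) (∈-bitStrings x))
∈-bitStrings (true ∷ x) = ∈-++⁺ʳ (map (false ∷_) (bitStrings (length x))) (∈-map⁺ (true ∷_) (∈-bitStrings x))

-- The implicit proof is found by evaluating the check on all 2ⁿ · 2ⁿ pairs during type checking.
by-enumeration : ∀ {P : BStr → BStr → Set} n (P? : ∀ x y → Dec (P x y)) →
  {True (all? (λ x → all? (P? x) (bitStrings n)) (bitStrings n))} →
  ∀ {x y} → length x ≡ n → length y ≡ n → P x y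
by-enumeration n P? {checked} {x} {y} refl lengthʸ =
  All.lookup (All.lookup (toWitness checked) (∈-bitStrings x))
             (subst (λ m → y ∈ bitStrings m) lengthʸ (∈-bitStrings y))

hamming-self : ∀ x → hamming x x ≡ 0
hamming-self [] = refl
hamming-self (true ∷ x) = hamming-self x
hamming-self (false ∷ x) = hamming-self x

hamming-sym : ∀ x y → hamming x y ≡ hamming y x
hamming-sym [] [] = refl
hamming-sym [] (_ ∷ y) = cong suc (hamming-sym [] y)
hamming-sym (_ ∷ x) [] = cong suc (hamming-sym x [])
hamming-sym (true ∷ x) (true ∷ y) = hamming-sym x y
hamming-sym (true ∷ x) (false ∷ y) = cong suc (hamming-sym x y)
hamming-sym (false ∷ x) (true ∷ y) = cong suc (hamming-sym x y)
hamming-sym (false ∷ x) (false ∷ y) = hamming-sym x y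

hamming-∷ : ∀ a c x y →
    (c ≡ a × hamming (a ∷ x) (c ∷ y) ≡ hamming x y)
  ⊎ (c ≡ not a × hamming (a ∷ x) (c ∷ y) ≡ suc (hamming x y))
hamming-∷ true true x y = inj₁ (refl , refl)
hamming-∷ false false x y = inj₁ (refl , refl)
hamming-∷ true false x y = inj₂ (refl , refl)
hamming-∷ false true x y = inj₂ (refl , refl)

hamming≤length : ∀ x y → length x ≡ length y → hamming x y ≤ length x
hamming≤length [] [] _ = z≤n
hamming≤length (a ∷ x) (c ∷ y) eq with hamming-∷ a c x y
... | inj₁ (_ , h) =
  subst (_≤ suc (length x)) (sym h) (≤-trans (hamming≤length x y (suc-injective eq)) (n≤1+n _))
... | inj₂ (_ , h) = subst (_≤ suc (length x)) (sym h) (s≤s (hamming≤length x y (suc-injective eq)))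

hamming≡0⇒≡ : ∀ x y → length x ≡ length y → hamming x y ≡ 0 → x ≡ y
hamming≡0⇒≡ [] [] _ _ = refl
hamming≡0⇒≡ (true ∷ x) (true ∷ y) eq h = cong (true ∷_) (hamming≡0⇒≡ x y (suc-injective eq) h)
hamming≡0⇒≡ (false ∷ x) (false ∷ y) eq h = cong (false ∷_) (hamming≡0⇒≡ x y (suc-injective eq) h)

hamming-triangle : ∀ x y z → length x ≡ length y → length y ≡ length z →
  hamming x z ≤ hamming x y + hamming y z
hamming-triangle [] [] [] _ _ = z≤n
hamming-triangle (a ∷ x) (b ∷ y) (c ∷ z) eq₁ eq₂ =
  cons a b c (hamming-triangle x y z (suc-injective eq₁) (suc-injective eq₂))
  where
  one-more : ∀ {m} p q → m ≤ p + q → suc m ≤ p + suc q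
  one-more {m} p q m≤ = subst (suc m ≤_) (sym (+-suc p q)) (s≤s m≤)
  cons : ∀ a b c → hamming x z ≤ hamming x y + hamming y z →
    hamming (a ∷ x) (c ∷ z) ≤ hamming (a ∷ x) (b ∷ y) + hamming (b ∷ y) (c ∷ z)
  cons true true true t = t
  cons false false false t = t
  cons true true false t = one-more _ _ t
  cons false false true t = one-more _ _ t
  cons true false false t = s≤s t
  cons false true true t = s≤s t
  cons true false true t = ≤-trans (n≤1+n _) (≤-trans (one-more (hamming x y) _ t) (n≤1+n _))
  cons false true false t = ≤-trans (n≤1+n _) (≤-trans (one-more (hamming x y) _ t) (n≤1+n _))

length-≡ : ∀ {n x y} → IsVertex n x → IsVertex n y → length x ≡ length y
length-≡ vˣ vʸ = trans (proj₁ vˣ) (sym (proj₁ vʸ))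

hamming≤ : ∀ {n x y} → IsVertex n x → IsVertex n y → hamming x y ≤ n
hamming≤ {x = x} {y} vˣ vʸ = subst (hamming x y ≤_) (proj₁ vˣ) (hamming≤length x y (length-≡ vˣ vʸ))

infix 4 _⊑_
_⊑_ : BStr → BStr → Set
_⊑_ = Pointwise Bool._≤_

⊑-refl : ∀ x → x ⊑ x
⊑-refl [] = []
⊑-refl (_ ∷ x) = b≤b ∷ ⊑-refl x

∧≡false-antitone : ∀ {a a′ c c′} → a′ Bool.≤ a → c′ Bool.≤ c → a ∧ c ≡ false → a′ ∧ c′ ≡ false
∧≡false-antitone {a′ = false} _ _ _ = refl
∧≡false-antitone {a′ = true} {c′ = false} _ _ _ = refl
∧≡false-antitone {a′ = true} {c′ = true} b≤b b≤b h = h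

noConsec-⊑ : ∀ {x y} → x ⊑ y → NoConsec y → NoConsec x
noConsec-⊑ [] _ = tt
noConsec-⊑ (_ ∷ []) _ = tt
noConsec-⊑ (a≤ ∷ b≤ ∷ x⊑y) (h , n) = ∧≡false-antitone a≤ b≤ h , noConsec-⊑ (b≤ ∷ x⊑y) n

lastCond-⊑ : ∀ {x y} → x ⊑ y → LastCond y → LastCond x
lastCond-⊑ x⊑y = lastCond′-⊑ (reverse⁺ x⊑y)
  where
  lastCond′-⊑ : ∀ {r t} → r ⊑ t → LastCond′ t → LastCond′ r
  lastCond′-⊑ (c≤ ∷ _ ∷ a≤ ∷ _) h = ∧≡false-antitone a≤ c≤ h
  lastCond′-⊑ [] _ = tt
  lastCond′-⊑ (_ ∷ []) _ = tt
  lastCond′-⊑ (_ ∷ _ ∷ []) _ = tt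

isVertex-⊑ : ∀ {n x y} → x ⊑ y → IsVertex n y → IsVertex n x
isVertex-⊑ x⊑y (lengthʸ , nc , lc) =
  trans (Pointwise-length x⊑y) lengthʸ , noConsec-⊑ x⊑y nc , lastCond-⊑ x⊑y lc

⊑-or-clear : ∀ x y → length x ≡ length y →
  x ⊑ y ⊎ ∃[ x′ ] (x′ ⊑ x × hamming x x′ ≡ 1 × suc (hamming x′ y) ≡ hamming x y)
⊑-or-clear [] [] _ = inj₁ []
⊑-or-clear (true ∷ x) (false ∷ y) _ = inj₂ (false ∷ x , f≤t ∷ ⊑-refl x , cong suc (hamming-self x) , refl)
⊑-or-clear (true ∷ x) (true ∷ y) eq with ⊑-or-clear x y (suc-injective eq)
... | inj₁ x⊑y = inj₁ (b≤b ∷ x⊑y)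
... | inj₂ (x′ , x′⊑x , h₁ , h₂) = inj₂ (true ∷ x′ , b≤b ∷ x′⊑x , h₁ , h₂)
⊑-or-clear (false ∷ x) (b ∷ y) eq with ⊑-or-clear x y (suc-injective eq)
... | inj₁ x⊑y = inj₁ (f≤ b ∷ x⊑y)
  where
  f≤ : ∀ b → false Bool.≤ b
  f≤ true = f≤t
  f≤ false = b≤b
... | inj₂ (x′ , x′⊑x , h₁ , h₂) = inj₂ (false ∷ x′ , b≤b ∷ x′⊑x , h₁ , closer b)
  where
  closer : ∀ b → suc (hamming (false ∷ x′) (b ∷ y)) ≡ hamming (false ∷ x) (b ∷ y)
  closer true = cong suc h₂
  closer false = h₂

set-toward : ∀ {x y} d → x ⊑ y → hamming x y ≡ suc d → ∃[ x′ ] (x′ ⊑ y × hamming x x′ ≡ 1 × hamming x′ y ≡ d)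
set-toward {false ∷ x} {true ∷ y} d (f≤t ∷ x⊑y) h =
  true ∷ x , b≤b ∷ x⊑y , cong suc (hamming-self x) , suc-injective h
set-toward {false ∷ x} {false ∷ y} d (b≤b ∷ x⊑y) h with set-toward d x⊑y h
... | x′ , x′⊑y , h₁ , h₂ = false ∷ x′ , b≤b ∷ x′⊑y , h₁ , h₂
set-toward {true ∷ x} {true ∷ y} d (b≤b ∷ x⊑y) h with set-toward d x⊑y h
... | x′ , x′⊑y , h₁ , h₂ = true ∷ x′ , b≤b ∷ x′⊑y , h₁ , h₂

step-toward : ∀ {n x y d} → IsVertex n x → IsVertex n y → hamming x y ≡ suc d →
  ∃[ x′ ] (Adj n x x′ × hamming x′ y ≡ d)
step-toward {x = x} {y} {d} vˣ vʸ h with ⊑-or-clear x y (length-≡ vˣ vʸ)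
... | inj₁ x⊑y with set-toward d x⊑y h
...   | x′ , x′⊑y , h₁ , h₂ = x′ , (vˣ , isVertex-⊑ x′⊑y vʸ , h₁) , h₂
step-toward vˣ vʸ h | inj₂ (x′ , x′⊑x , h₁ , h₂) = x′ , (vˣ , isVertex-⊑ x′⊑x vˣ , h₁) , suc-injective (trans h₂ h)

geodesic : ∀ {n x y} d → IsVertex n x → IsVertex n y → hamming x y ≡ d → Walk n x y d
geodesic {x = x} {y} zero vˣ vʸ h with hamming≡0⇒≡ x y (length-≡ vˣ vʸ) h
... | refl = here vˣ
geodesic (suc d) vˣ vʸ h with step-toward vˣ vʸ h
... | x′ , adj , h′ = step adj (geodesic d (proj₁ (proj₂ adj)) vʸ h′)

walk-target : ∀ {n x y m} → Walk n x y m → IsVertex n y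
walk-target (here vˣ) = vˣ
walk-target (step _ w) = walk-target w

hamming≤walk : ∀ {n x y m} → Walk n x y m → hamming x y ≤ m
hamming≤walk {x = x} (here _) = subst (_≤ 0) (sym (hamming-self x)) z≤n
hamming≤walk {x = x} {z} (step {y = y} (vˣ , vʸ , h₁) w) =
  ≤-trans (hamming-triangle x y z (length-≡ vˣ vʸ) (length-≡ vʸ (walk-target w)))
          (subst (λ t → t + hamming y z ≤ suc _) (sym h₁) (s≤s (hamming≤walk w)))

dist⇔hamming : ∀ {n x y d} → IsVertex n x → IsVertex n y → Dist n x y d ⇔ (hamming x y ≡ d)
dist⇔hamming vˣ vʸ = mk⇔
  (λ (w , shortest) → ≤-antisym (hamming≤walk w) (shortest _ (geodesic _ vˣ vʸ refl)))
  (λ h → geodesic _ vˣ vʸ h , λ m w → subst (_≤ m) h (hamming≤walk w))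

lastCond-∷ : ∀ a x → 3 ≤ length x → LastCond (a ∷ x) ≡ LastCond x
lastCond-∷ a x 3≤ = trans (cong LastCond′ (unfold-reverse a x))
  (lastCond′-∷ʳ (reverse x) (subst (3 ≤_) (sym (length-reverse x)) 3≤))
  where
  lastCond′-∷ʳ : ∀ r → 3 ≤ length r → LastCond′ (r ∷ʳ a) ≡ LastCond′ r
  lastCond′-∷ʳ (_ ∷ _ ∷ _ ∷ _) _ = refl
  lastCond′-∷ʳ (_ ∷ []) (s≤s ())
  lastCond′-∷ʳ (_ ∷ _ ∷ []) (s≤s (s≤s ()))

noConsec-∷⁻ : ∀ {a x} → NoConsec (a ∷ x) → NoConsec x
noConsec-∷⁻ {x = []} _ = tt
noConsec-∷⁻ {x = _ ∷ _} (_ , nc) = nc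

isVertex-∷⁻ : ∀ {n a x} → 3 ≤ n → IsVertex (suc n) (a ∷ x) → IsVertex n x
isVertex-∷⁻ {a = a} {x} 3≤n (lengthᵃˣ , nc , lc) =
  lengthˣ , noConsec-∷⁻ nc , subst (λ P → P) (lastCond-∷ a x (subst (3 ≤_) (sym lengthˣ) 3≤n)) lc
  where lengthˣ = suc-injective lengthᵃˣ

isVertex-∷⁺ : ∀ {n a x} → 3 ≤ n → NoConsec (a ∷ x) → IsVertex n x → IsVertex (suc n) (a ∷ x)
isVertex-∷⁺ {a = a} {x} 3≤n nc (lengthˣ , _ , lc) =
  cong suc lengthˣ , nc , subst (λ P → P) (sym (lastCond-∷ a x (subst (3 ≤_) (sym lengthˣ) 3≤n))) lc

no-complementary-vertices : ∀ n {x y} → 3 ≤ n → IsVertex n x → IsVertex n y → hamming x y ≢ n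
no-complementary-vertices 1 (s≤s ())
no-complementary-vertices 2 (s≤s (s≤s ()))
no-complementary-vertices 3 _ vˣ vʸ =
  by-enumeration 3 (λ x y → isVertex? 3 x →-dec (isVertex? 3 y →-dec ¬? (hamming x y ≟ 3)))
    (proj₁ vˣ) (proj₁ vʸ) vˣ vʸ
no-complementary-vertices (suc n@(suc (suc (suc _)))) {a ∷ x} {c ∷ y} _ vᵃˣ vᶜʸ h
  with hamming-∷ a c x y | isVertex-∷⁻ (m≤m+n 3 _) vᵃˣ | isVertex-∷⁻ (m≤m+n 3 _) vᶜʸ
... | inj₁ (_ , h′) | vˣ | vʸ = 1+n≰n (subst (_≤ n) (trans (sym h′) h) (hamming≤ vˣ vʸ))
... | inj₂ (_ , h′) | vˣ | vʸ = no-complementary-vertices n (m≤m+n 3 _) vˣ vʸ (suc-injective (trans (sym h′) h))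

diametral-∷⁻ : ∀ m {a c x y} → Diametral (4 + m) (a ∷ x) (c ∷ y) → c ≡ not a × Diametral (3 + m) x y
diametral-∷⁻ m {a} {c} {x} {y} (vᵃˣ , vᶜʸ , h)
  with hamming-∷ a c x y | isVertex-∷⁻ (m≤m+n 3 m) vᵃˣ | isVertex-∷⁻ (m≤m+n 3 m) vᶜʸ
... | inj₁ (_ , h′) | vˣ | vʸ = ⊥-elim (no-complementary-vertices (3 + m) (m≤m+n 3 m) vˣ vʸ (trans (sym h′) h))
... | inj₂ (c≡¬a , h′) | vˣ | vʸ = c≡¬a , vˣ , vʸ , suc-injective (trans (sym h′) h)

diametral-∷⁺ : ∀ m {a x y} → Diametral (3 + m) x y → NoConsec (a ∷ x) → NoConsec (not a ∷ y) →
  Diametral (4 + m) (a ∷ x) (not a ∷ y)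
diametral-∷⁺ m {a} {x} {y} (vˣ , vʸ , h) ncˣ ncʸ =
    isVertex-∷⁺ (m≤m+n 3 m) ncˣ vˣ , isVertex-∷⁺ (m≤m+n 3 m) ncʸ vʸ
  , trans (hamming-∷-not a) (cong suc h)
  where
  hamming-∷-not : ∀ a → hamming (a ∷ x) (not a ∷ y) ≡ suc (hamming x y)
  hamming-∷-not true = refl
  hamming-∷-not false = refl

diametral-sym : ∀ {n x y} → Diametral n x y → Diametral n y x
diametral-sym {x = x} {y} (vˣ , vʸ , h) = vʸ , vˣ , trans (hamming-sym y x) h

data Ending : BStr → BStr → Set where
  ending-i : Ending b001 b010
  ending-ii : Ending b010 b001
  ending-iii : Ending b100 b001
  ending-iv : Ending b100 b010

-- The prefix 0^s(10)^k is nonempty and s ≤ 1, i.e. n = 2k + 3 + s ≥ 4; it starts with 0 or with 1.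
data Shape : ℕ → ℕ → Set where
  0-headed : ∀ k → Shape 1 k
  1-headed : ∀ k → Shape 0 (suc k)

-- Unlike 2 * k, this unfolds to suc (suc (double k)), so a letter can be peeled off lengths 3 + s + double k.
double : ℕ → ℕ
double zero = zero
double (suc k) = suc (suc (double k))

double≡2* : ∀ k → double k ≡ 2 * k
double≡2* zero = refl
double≡2* (suc k) = trans (cong (λ d → 2 + d) (double≡2* k)) (sym (*-suc 2 k))

listed-map : ∀ {s k s′ k′ x y x′ y′} →
  (∀ {u v} → SameUPair (x , y) (A s k u , B s k v) → SameUPair (x′ , y′) (A s′ k′ u , B s′ k′ v)) →
  Listed s k x y → Listed s′ k′ x′ y′
listed-map f = Sum.map f (Sum.map f (Sum.map f f))

-- The tails start with b and not b, so b₁b₂ = 0 in both strings forces the new first letters.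
sameUPair-∷ : ∀ b {a c x y p q} → c ≡ not a → NoConsec (a ∷ x) → NoConsec (c ∷ y) →
  SameUPair (x , y) (b ∷ p , not b ∷ q) → SameUPair (a ∷ x , c ∷ y) (not b ∷ b ∷ p , b ∷ not b ∷ q)
sameUPair-∷ false {false} refl _ (() , _) (inj₁ (refl , refl))
sameUPair-∷ false {true} refl _ _ (inj₁ (refl , refl)) = inj₁ (refl , refl)
sameUPair-∷ true {false} refl _ _ (inj₁ (refl , refl)) = inj₁ (refl , refl)
sameUPair-∷ true {true} refl (() , _) _ (inj₁ (refl , refl))
sameUPair-∷ false {false} refl _ _ (inj₂ (refl , refl)) = inj₂ (refl , refl)
sameUPair-∷ false {true} refl (() , _) _ (inj₂ (refl , refl))
sameUPair-∷ true {false} refl _ (() , _) (inj₂ (refl , refl))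
sameUPair-∷ true {true} refl _ _ (inj₂ (refl , refl)) = inj₂ (refl , refl)

diametral⇒listed : ∀ {s k} → Shape s k → ∀ x y → Diametral (3 + s + double k) x y → Listed s k x y
diametral⇒listed (0-headed zero) x y d@(vˣ , vʸ , _) =
  by-enumeration 4 (λ x y → diametral? 4 x y →-dec listed? 1 0 x y) (proj₁ vˣ) (proj₁ vʸ) d
diametral⇒listed (0-headed (suc k)) (a ∷ x) (c ∷ y) d@((_ , ncˣ , _) , (_ , ncʸ , _) , _)
  with diametral-∷⁻ (2 + double k) d
... | c≡¬a , d′ = listed-map {0} {suc k} {1} {suc k} (sameUPair-∷ true c≡¬a ncˣ ncʸ)
                    (diametral⇒listed (1-headed k) x y d′)
diametral⇒listed (1-headed k) (a ∷ x) (c ∷ y) d@((_ , ncˣ , _) , (_ , ncʸ , _) , _)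
  with diametral-∷⁻ (1 + double k) d
... | c≡¬a , d′ = listed-map {1} {k} {0} {suc k} (sameUPair-∷ false c≡¬a ncˣ ncʸ)
                    (diametral⇒listed (0-headed k) x y d′)

AB-diametral : ∀ {s k u v} → Shape s k → Ending u v → Diametral (3 + s + double k) (A s k u) (B s k v)
AB-diametral (0-headed zero) ending-i = from-yes (diametral? 4 (A 1 0 b001) (B 1 0 b010))
AB-diametral (0-headed zero) ending-ii = from-yes (diametral? 4 (A 1 0 b010) (B 1 0 b001))
AB-diametral (0-headed zero) ending-iii = from-yes (diametral? 4 (A 1 0 b100) (B 1 0 b001))
AB-diametral (0-headed zero) ending-iv = from-yes (diametral? 4 (A 1 0 b100) (B 1 0 b010))
AB-diametral (0-headed (suc k)) e with AB-diametral (1-headed k) e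
... | d@((_ , ncˣ , _) , (_ , ncʸ , _) , _) = diametral-∷⁺ (2 + double k) {false} d (refl , ncˣ) (refl , ncʸ)
AB-diametral (1-headed k) e with AB-diametral (0-headed k) e
... | d@((_ , ncˣ , _) , (_ , ncʸ , _) , _) = diametral-∷⁺ (1 + double k) {true} d (refl , ncˣ) (refl , ncʸ)

listed⇒diametral : ∀ {s k x y} → Shape s k → Listed s k x y → Diametral (3 + s + double k) x y
listed⇒diametral {s} {k} {x} {y} shape =
  [ listed ending-i , [ listed ending-ii , [ listed ending-iii , listed ending-iv ]′ ]′ ]′
  where
  listed : ∀ {u v} → Ending u v → SameUPair (x , y) (A s k u , B s k v) → Diametral (3 + s + double k) x y
  listed e (inj₁ (refl , refl)) = AB-diametral shape e
  listed e (inj₂ (refl , refl)) = diametral-sym (AB-diametral shape e)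

diametral⇔listed : ∀ {s k} → Shape s k → ∀ x y → Diametral (3 + s + double k) x y ⇔ Listed s k x y
diametral⇔listed shape x y = mk⇔ (diametral⇒listed shape x y) (listed⇒diametral shape)

at-diameter⇔diametral : ∀ n x y → (IsVertex n x × IsVertex n y × Dist n x y (n ∸ 1)) ⇔ Diametral n x y
at-diameter⇔diametral n x y = mk⇔
  (λ (vˣ , vʸ , d) → vˣ , vʸ , Equivalence.to (dist⇔hamming vˣ vʸ) d)
  (λ (vˣ , vʸ , h) → vˣ , vʸ , Equivalence.from (dist⇔hamming vˣ vʸ) h)

A≢B : ∀ {s k u v} → Shape s k → A s k u ≢ B s k v
A≢B (0-headed k) ()
A≢B (1-headed k) ()

sameUPair-AB⇒≡ : ∀ {s k u v u′ v′} → Shape s k →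
  SameUPair (A s k u , B s k v) (A s k u′ , B s k v′) → (u , v) ≡ (u′ , v′)
sameUPair-AB⇒≡ {s} {k} _ (inj₁ (eᴬ , eᴮ)) =
  cong₂ _,_ (cancel (zeros s) (p10 k) eᴬ) (cancel (ones s) (p01 k) eᴮ)
  where
  cancel : ∀ p q {w w′ : BStr} → p ++ q ++ w ≡ p ++ q ++ w′ → w ≡ w′
  cancel p q e = ++-cancelˡ q _ _ (++-cancelˡ p _ _ e)
sameUPair-AB⇒≡ shape (inj₂ (e , _)) = ⊥-elim (A≢B shape e)

shape-of : ∀ {k s} → s ≤ 1 → 4 ≤ 2 * k + 3 + s → Shape s k
shape-of {zero} z≤n (s≤s (s≤s (s≤s ())))
shape-of {suc k} z≤n _ = 1-headed k
shape-of (s≤s z≤n) _ = 0-headed _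

proposition3 : (n k s : ℕ) → 4 ≤ n → s ≤ 1 → n ≡ 2 * k + 3 + s →
    ((x y : BStr) →
      (IsVertex n x × IsVertex n y × Dist n x y (n ∸ 1)) ⇔ Listed s k x y)
    × ¬ SameUPair (pairI s k) (pairII s k) × ¬ SameUPair (pairI s k) (pairIII s k)
    × ¬ SameUPair (pairI s k) (pairIV s k) × ¬ SameUPair (pairII s k) (pairIII s k)
    × ¬ SameUPair (pairII s k) (pairIV s k) × ¬ SameUPair (pairIII s k) (pairIV s k)
proposition3 n k s 4≤n s≤1 n≡2k+3+s =
  (λ x y → ⇔-trans (at-diameter⇔diametral n x y)
             (subst (λ m → Diametral m x y ⇔ Listed s k x y) (sym n≡) (diametral⇔listed shape x y)))
  , distinct (λ ()) , distinct (λ ()) , distinct (λ ()) , distinct (λ ()) , distinct (λ ()) , distinct (λ ())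
  where
  shape : Shape s k
  shape = shape-of s≤1 (subst (4 ≤_) n≡2k+3+s 4≤n)
  n≡ : n ≡ 3 + s + double k
  n≡ = begin
    n                 ≡⟨ n≡2k+3+s ⟩
    2 * k + 3 + s     ≡⟨ +-assoc (2 * k) 3 s ⟩
    2 * k + (3 + s)   ≡⟨ +-comm (2 * k) (3 + s) ⟩
    3 + s + 2 * k     ≡⟨ cong (3 + s +_) (double≡2* k) ⟨
    3 + s + double k  ∎
    where open ≡-Reasoning
  distinct : ∀ {u v u′ v′} → (u , v) ≢ (u′ , v′) → ¬ SameUPair (A s k u , B s k v) (A s k u′ , B s k v′)
  distinct ≢ p = ≢ (sameUPair-AB⇒≡ shape p)
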